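{- The pair $(G,h_x)$ is AT whenever (i) $G$ is a $\theta$-graph and $x$ is one of its two vertices of degree 3; or (ii) $G$ is a $T$-graph (with special vertex $x$) and two of the paths $P_1,P_2,P_3$ have lengths of opposite parities; or (iii) $G$ is formed from a $T$-graph (with special vertex $x$) by adding an extra vertex whose neighborhood is exactly $\{z_1,z_2,z_3\}$.
   Context: For an orientation $D$ of a graph, a spanning Eulerian subgraph is a spanning subgraph in which every vertex has indegree equal to outdegree; $EE(D)$ (resp. $EO(D)$) is the number of spanning Eulerian subgraphs with an even (resp. odd) number of edges. $D$ is AT if $EE(D)\ne EO(D)$. For $x\in V(G)$, $h_x(x)=1$ and $h_x(v)=0$ for $v\ne x$; $(G,h_x)$ is AT if $G$ has an AT orientation in which every vertex $v$ has indegree at least $h_x(v)+1$ (equivalently outdegree at most $d_G(v)-h_x(v)-1$). A $\theta$-graph consists of two vertices joined by three internally disjoint paths (a simple graph). A $T$-graph is formed from vertices $x,z_1,z_2,z_3$ by making $z_1,z_2,z_3$ pairwise adjacent and joining each $z_i$ to $x$ by a path $P_i$ of length at least 1, the paths $P_i$ being internally disjoint and disjoint from the other vertices; equivalently, $K_4$ with the edges at $x$ subdivided zero or more times. -}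

module Defs where

open import Data.Nat using (ℕ; zero; suc; _+_; _≡ᵇ_; _≤_; _<_; _%_)
open import Data.Bool using (Bool; true; false; if_then_else_; _∧_)
open import Data.List using (List; []; _∷_; _++_; map; length; upTo)
open import Data.Vec using (Vec; []; _∷_)
open import Data.Product using (_×_; _,_; Σ; proj₁; proj₂)
open import Relation.Nullary using (¬_)
open import Relation.Binary.PropositionalEquality using (_≡_)

record Graph : Set where
  constructor mkGraph
  field
    nV : ℕ                 -- vertices are 0 … nV-1
    E  : List (ℕ × ℕ)      -- each undirected edge listed once

open Graph public

Arc : Set
Arc = ℕ × ℕ               -- (tail , head)

-- An orientation chooses a direction for each edge:
-- true : u → v ,  false : v → u   for the edge (u , v).
Orientation : Graph → Set
Orientation G = Vec Bool (length (E G))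

orientArcs : (es : List (ℕ × ℕ)) → Vec Bool (length es) → List Arc
orientArcs [] [] = []
orientArcs ((u , v) ∷ es) (true  ∷ bs) = (u , v) ∷ orientArcs es bs
orientArcs ((u , v) ∷ es) (false ∷ bs) = (v , u) ∷ orientArcs es bs

arcs : (G : Graph) → Orientation G → List Arc
arcs G o = orientArcs (E G) o

indeg : List Arc → ℕ → ℕ
indeg [] v = 0
indeg ((a , b) ∷ as) v = if b ≡ᵇ v then suc (indeg as v) else indeg as v

outdeg : List Arc → ℕ → ℕ
outdeg [] v = 0
outdeg ((a , b) ∷ as) v = if a ≡ᵇ v then suc (outdeg as v) else outdeg as v

-- all sub-collections of arcs (spanning subgraphs of the orientation)
sublists : {A : Set} → List A → List (List A)
sublists [] = [] ∷ []
sublists (a ∷ as) = sublists as ++ map (a ∷_) (sublists as)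

allB : (ℕ → Bool) → List ℕ → Bool
allB p [] = true
allB p (x ∷ xs) = p x ∧ allB p xs

isEulerian : ℕ → List Arc → Bool
isEulerian n H = allB (λ v → indeg H v ≡ᵇ outdeg H v) (upTo n)

evenB : ℕ → Bool
evenB m = m % 2 ≡ᵇ 0

countEul : ℕ → Bool → List (List Arc) → ℕ
countEul n par [] = 0
countEul n par (H ∷ Hs) =
  if isEulerian n H ∧ (evenB (length H) ≡ᵇB par)
  then suc (countEul n par Hs) else countEul n par Hs
  where
    _≡ᵇB_ : Bool → Bool → Bool
    true  ≡ᵇB b = b
    false ≡ᵇB true = false
    false ≡ᵇB false = true

EE : (G : Graph) → Orientation G → ℕ
EE G o = countEul (nV G) true (sublists (arcs G o))

EO : (G : Graph) → Orientation G → ℕ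
EO G o = countEul (nV G) false (sublists (arcs G o))

hx : ℕ → ℕ → ℕ
hx x v = if v ≡ᵇ x then 1 else 0

IsAT : (G : Graph) → (ℕ → ℕ) → Set
IsAT G h = Σ (Orientation G) λ o →
  (¬ (EE G o ≡ EO G o)) ×
  ((v : ℕ) → v < nV G → suc (h v) ≤ indeg (arcs G o) v)

-- path from u to w with k fresh internal vertices s, s+1, …, s+k-1
-- (length k+1)
pathEdges : ℕ → ℕ → ℕ → ℕ → List (ℕ × ℕ)
pathEdges u s zero w = (u , w) ∷ []
pathEdges u s (suc k) w = (u , s) ∷ pathEdges s (suc s) k w

-- θ-graph: vertices 0 and 1 (degree 3) joined by three paths with
-- i, j, k internal vertices (lengths i+1, j+1, k+1).
thetaGraph : ℕ → ℕ → ℕ → Graph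
thetaGraph i j k = mkGraph (2 + i + j + k)
  (pathEdges 0 2 i 1 ++ pathEdges 0 (2 + i) j 1 ++ pathEdges 0 (2 + i + j) k 1)

-- T-graph: x = 0, z₁ = 1, z₂ = 2, z₃ = 3, triangle z₁z₂z₃, and paths
-- P_t from x to z_t with i, j, k internal vertices (lengths i+1, j+1, k+1).
TEdges : ℕ → ℕ → ℕ → List (ℕ × ℕ)
TEdges i j k =
  (1 , 2) ∷ (1 , 3) ∷ (2 , 3) ∷
  (pathEdges 0 4 i 1 ++ pathEdges 0 (4 + i) j 2 ++ pathEdges 0 (4 + i + j) k 3)

TGraph : ℕ → ℕ → ℕ → Graph
TGraph i j k = mkGraph (4 + i + j + k) (TEdges i j k)

TGraphPlus : ℕ → ℕ → ℕ → Graph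
TGraphPlus i j k = mkGraph (5 + i + j + k)
  ((w , 1) ∷ (w , 2) ∷ (w , 3) ∷ TEdges i j k)
  where w = 4 + i + j + k

module Submission where

-- Orient each path of G consistently, so that its arcs form a directed path.
-- An internal vertex of a directed path has one in-arc and one out-arc, so a
-- spanning Eulerian subgraph contains all arcs of the path or none of them.  Thus
-- the Eulerian subgraphs correspond to those of the small digraph obtained by
-- contracting every path to a single arc, where a path with k internal vertices
-- contributes k extra edges; for EE and EO only k mod 2 matters.  The contracted
-- digraphs have at most five vertices, and their counts are found by evaluation.

open import Defs
open import Data.Nat using (ℕ; suc; _%_)
open import Data.Product using (_×_)
open import Data.Sum using (_⊎_)
open import Relation.Nullary using (¬_)
open import Relation.Binary.PropositionalEquality using (_≡_; _≢_)

open import Data.Nat using (zero; _+_; _≤_; _<_; _≡ᵇ_; _≤ᵇ_; _≟_; _<?_; z≤n; s≤s; z<s)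
open import Data.Nat.Properties
open import Data.Nat.DivMod using (%-distribˡ-+; m%n%n≡m%n; m%n<n)
open import Algebra.Properties.CommutativeSemigroup +-commutativeSemigroup using (interchange)
open import Data.Bool using (Bool; true; false; if_then_else_; _∧_; not)
open import Data.Bool.Properties using (T-≡; ⇔→≡; ¬-not)
open import Data.List using (List; []; _∷_; _++_; map; length; upTo)
open import Data.List.Properties using (++-assoc; ++-identityʳ; length-++; length-++-sucʳ)
open import Data.List.Relation.Unary.All using (All; []; _∷_)
open import Data.List.Relation.Unary.All.Properties using (++⁺)
open import Data.List.Membership.Propositional using (_∈_)
open import Data.List.Membership.Propositional.Properties using (∈-upTo⁺; ∈-upTo⁻)
open import Data.List.Relation.Unary.Any using (here; there)
open import Data.Vec using (Vec; []; _∷_; replicate)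
open import Data.Product using (_,_; proj₁; proj₂)
open import Data.Sum using (inj₁; inj₂; [_,_]) renaming (map to ⊎-map)
open import Data.Empty using (⊥-elim)
open import Function using (_∘_; id)
open import Function.Bundles using (_⇔_; mk⇔; Equivalence)
open import Relation.Nullary using (yes; no)
open import Relation.Nullary.Decidable using (dec-true; dec-false)
open import Relation.Binary.PropositionalEquality
  using (refl; sym; trans; cong; cong₂; subst; ≢-sym; module ≡-Reasoning)

open ≡-Reasoning

-- 1. Counting over sublists

count : {A : Set} → (A → Bool) → List A → ℕ
count P [] = 0
count P (x ∷ xs) = if P x then suc (count P xs) else count P xs

count-++ : {A : Set} (P : A → Bool) (xs ys : List A) →
           count P (xs ++ ys) ≡ count P xs + count P ys
count-++ P [] ys = refl
count-++ P (x ∷ xs) ys with P x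
... | true  = cong suc (count-++ P xs ys)
... | false = count-++ P xs ys

count-map : {A B : Set} (P : B → Bool) (f : A → B) (xs : List A) →
            count P (map f xs) ≡ count (P ∘ f) xs
count-map P f [] = refl
count-map P f (x ∷ xs) with P (f x)
... | true  = cong suc (count-map P f xs)
... | false = count-map P f xs

count-ext : {A : Set} {P Q : A → Bool} → (∀ x → P x ≡ Q x) → (xs : List A) →
            count P xs ≡ count Q xs
count-ext e [] = refl
count-ext {P = P} {Q} e (x ∷ xs) rewrite e x with Q x
... | true  = cong suc (count-ext e xs)
... | false = count-ext e xs

count-sublists-∷ : {A : Set} (P : List A → Bool) (a : A) (R : List A) →
  count P (sublists (a ∷ R)) ≡ count P (sublists R) + count (P ∘ (a ∷_)) (sublists R)
count-sublists-∷ P a R =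
  trans (count-++ P (sublists R) _) (cong (count P (sublists R) +_) (count-map P (a ∷_) (sublists R)))

-- If every member of R satisfies Q, so does every sublist; a test failing on all
-- such lists counts no sublist of R.
count-sublists-none : {A : Set} (Q : A → Set) (P : List A → Bool) →
  (∀ H → All Q H → P H ≡ false) → ∀ {R} → All Q R → count P (sublists R) ≡ 0
count-sublists-none Q P none {[]} [] rewrite none [] [] = refl
count-sublists-none Q P none {a ∷ R} (qa ∷ qR) =
  trans (count-sublists-∷ P a R)
        (cong₂ _+_ (count-sublists-none Q P none qR)
                   (count-sublists-none Q (P ∘ (a ∷_)) (λ H qH → none (a ∷ H) (qa ∷ qH)) qR))

-- 2. Degrees and balance of arc lists

≡ᵇ-refl : ∀ a → (a ≡ᵇ a) ≡ true
≡ᵇ-refl a = dec-true (a ≟ a) refl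

≡ᵇ-false : ∀ {a b} → a ≢ b → (a ≡ᵇ b) ≡ false
≡ᵇ-false {a} {b} = dec-false (a ≟ b)

≡ᵇ⇔≡ : ∀ a b → (a ≡ᵇ b) ≡ true ⇔ a ≡ b
≡ᵇ⇔≡ a b = mk⇔ (λ e → ≡ᵇ⇒≡ a b (Equivalence.from T-≡ e)) (λ e → Equivalence.to T-≡ (≡⇒≡ᵇ a b e))

indeg-++ : ∀ X Y v → indeg (X ++ Y) v ≡ indeg X v + indeg Y v
indeg-++ [] Y v = refl
indeg-++ ((a , c) ∷ X) Y v with c ≡ᵇ v
... | true  = cong suc (indeg-++ X Y v)
... | false = indeg-++ X Y v

outdeg-++ : ∀ X Y v → outdeg (X ++ Y) v ≡ outdeg X v + outdeg Y v
outdeg-++ [] Y v = refl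
outdeg-++ ((a , c) ∷ X) Y v with a ≡ᵇ v
... | true  = cong suc (outdeg-++ X Y v)
... | false = outdeg-++ X Y v

arc : Bool → ℕ → ℕ → Arc
arc true  u w = u , w
arc false u w = w , u

Misses : ℕ → Arc → Set
Misses v (a , c) = a ≢ v × c ≢ v

Avoid : ℕ → List Arc → Set
Avoid v = All (Misses v)

arc-misses : ∀ b {u w v} → u ≢ v → w ≢ v → Misses v (arc b u w)
arc-misses true  u≢v w≢v = u≢v , w≢v
arc-misses false u≢v w≢v = w≢v , u≢v

avoid-indeg : ∀ {v X} → Avoid v X → indeg X v ≡ 0
avoid-indeg [] = refl
avoid-indeg {v} {(a , c) ∷ X} ((_ , c≢v) ∷ av) rewrite ≡ᵇ-false c≢v = avoid-indeg av

avoid-outdeg : ∀ {v X} → Avoid v X → outdeg X v ≡ 0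
avoid-outdeg [] = refl
avoid-outdeg {v} {(a , c) ∷ X} ((a≢v , _) ∷ av) rewrite ≡ᵇ-false a≢v = avoid-outdeg av

ArcBelow : ℕ → Arc → Set
ArcBelow m (a , c) = a < m × c < m

Below : ℕ → List Arc → Set
Below m = All (ArcBelow m)

arc-below : ∀ b {u w m} → u < m → w < m → ArcBelow m (arc b u w)
arc-below true  u<m w<m = u<m , w<m
arc-below false u<m w<m = w<m , u<m

below-avoid : ∀ {m v X} → m ≤ v → Below m X → Avoid v X
below-avoid m≤v [] = []
below-avoid m≤v ((a<m , c<m) ∷ bs) =
  (<⇒≢ (<-≤-trans a<m m≤v) , <⇒≢ (<-≤-trans c<m m≤v)) ∷ below-avoid m≤v bs

-- In- and out-degree at v differ, so no Eulerian subgraph contains exactly these arcs at v.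
Unbalanced : ℕ → List Arc → Set
Unbalanced v X = indeg X v ≢ outdeg X v

unbalanced-++ : ∀ {v} X Y → Avoid v Y → Unbalanced v X →
                Unbalanced v (X ++ Y) × Unbalanced v (Y ++ X)
unbalanced-++ {v} X Y av ub
  rewrite indeg-++ X Y v | outdeg-++ X Y v | indeg-++ Y X v | outdeg-++ Y X v
        | avoid-indeg av | avoid-outdeg av | +-identityʳ (indeg X v) | +-identityʳ (outdeg X v)
  = ub , ub

pendant-unbalanced : ∀ b {x s} → x ≢ s →
  Unbalanced s (arc b x s ∷ []) × Unbalanced s (arc b s x ∷ [])
pendant-unbalanced true  {x} {s} x≢s rewrite ≡ᵇ-false x≢s | ≡ᵇ-refl s = (λ ()) , (λ ())
pendant-unbalanced false {x} {s} x≢s rewrite ≡ᵇ-false x≢s | ≡ᵇ-refl s = (λ ()) , (λ ())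

-- X and Y have the same in-minus-out balance at every vertex.
_~_ : List Arc → List Arc → Set
X ~ Y = ∀ v → indeg X v + outdeg Y v ≡ outdeg X v + indeg Y v

~-refl : ∀ X → X ~ X
~-refl X v = +-comm (indeg X v) (outdeg X v)

~-++ : ∀ X X' Y Y' → X ~ X' → Y ~ Y' → (X ++ Y) ~ (X' ++ Y')
~-++ X X' Y Y' p q v = begin
    indeg (X ++ Y) v + outdeg (X' ++ Y') v
  ≡⟨ cong₂ _+_ (indeg-++ X Y v) (outdeg-++ X' Y' v) ⟩
    (indeg X v + indeg Y v) + (outdeg X' v + outdeg Y' v)
  ≡⟨ interchange (indeg X v) _ _ _ ⟩
    (indeg X v + outdeg X' v) + (indeg Y v + outdeg Y' v)
  ≡⟨ cong₂ _+_ (p v) (q v) ⟩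
    (outdeg X v + indeg X' v) + (outdeg Y v + indeg Y' v)
  ≡⟨ interchange (outdeg X v) _ _ _ ⟩
    (outdeg X v + outdeg Y v) + (indeg X' v + indeg Y' v)
  ≡⟨ sym (cong₂ _+_ (outdeg-++ X Y v) (indeg-++ X' Y' v)) ⟩
    outdeg (X ++ Y) v + indeg (X' ++ Y') v ∎

splice-~ : ∀ b u s w → (arc b u s ∷ arc b s w ∷ []) ~ (arc b u w ∷ [])
splice-~ true u s w v with u ≡ᵇ v | s ≡ᵇ v | w ≡ᵇ v
... | true  | true  | true  = refl
... | true  | true  | false = refl
... | true  | false | true  = refl
... | true  | false | false = refl
... | false | true  | true  = refl
... | false | true  | false = refl
... | false | false | true  = refl
... | false | false | false = refl
splice-~ false u s w v with u ≡ᵇ v | s ≡ᵇ v | w ≡ᵇ v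
... | true  | true  | true  = refl
... | true  | true  | false = refl
... | true  | false | true  = refl
... | true  | false | false = refl
... | false | true  | true  = refl
... | false | true  | false = refl
... | false | false | true  = refl
... | false | false | false = refl

Balanced : ℕ → List Arc → Set
Balanced n X = ∀ v → v < n → indeg X v ≡ outdeg X v

allB-true : ∀ (p : ℕ → Bool) xs → allB p xs ≡ true ⇔ (∀ x → x ∈ xs → p x ≡ true)
allB-true p xs = mk⇔ (to xs) (from xs)
  where
    to : ∀ xs → allB p xs ≡ true → ∀ x → x ∈ xs → p x ≡ true
    to (y ∷ ys) e x (here refl) with p y | e
    ... | true | _ = refl
    to (y ∷ ys) e x (there x∈ys) with p y | e
    ... | true | e' = to ys e' x x∈ys
    from : ∀ xs → (∀ x → x ∈ xs → p x ≡ true) → allB p xs ≡ true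
    from [] _ = refl
    from (y ∷ ys) h rewrite h y (here refl) = from ys (λ x m → h x (there m))

isEulerian⇔balanced : ∀ n X → isEulerian n X ≡ true ⇔ Balanced n X
isEulerian⇔balanced n X = mk⇔
  (λ e v v<n → Equivalence.to (≡ᵇ⇔≡ _ _) (Equivalence.to (allB-true _ (upTo n)) e v (∈-upTo⁺ v<n)))
  (λ bal → Equivalence.from (allB-true _ (upTo n))
             (λ v v∈ → Equivalence.from (≡ᵇ⇔≡ _ _) (bal v (∈-upTo⁻ v∈))))

isEulerian-≡ : ∀ {m n X Y} → (Balanced n X → Balanced m Y) → (Balanced m Y → Balanced n X) →
               isEulerian n X ≡ isEulerian m Y
isEulerian-≡ {m} {n} {X} {Y} f g = ⇔→≡ (mk⇔
  (λ e → Equivalence.from (isEulerian⇔balanced m Y) (f (Equivalence.to (isEulerian⇔balanced n X) e)))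
  (λ e → Equivalence.from (isEulerian⇔balanced n X) (g (Equivalence.to (isEulerian⇔balanced m Y) e))))

isEulerian-~ : ∀ n X Y → X ~ Y → isEulerian n X ≡ isEulerian n Y
isEulerian-~ n X Y p = isEulerian-≡ {n} {n} {X} {Y}
  (λ bal v v<n → sym (+-cancelˡ-≡ (outdeg X v) _ _ (trans (cong (_+ outdeg Y v) (sym (bal v v<n))) (p v))))
  (λ bal v v<n → +-cancelʳ-≡ (outdeg Y v) _ _ (trans (p v) (cong (outdeg X v +_) (bal v v<n))))

isEulerian-reject : ∀ n X {v} → v < n → Unbalanced v X → isEulerian n X ≡ false
isEulerian-reject n X v<n ub = ¬-not (λ e → ub (Equivalence.to (isEulerian⇔balanced n X) e _ v<n))

-- Vertices beyond all arcs are trivially balanced.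
isEulerian-restrict : ∀ m n X → m ≤ n → Below m X → isEulerian n X ≡ isEulerian m X
isEulerian-restrict m n X m≤n below = isEulerian-≡ {m} {n} {X} {X}
  (λ bal v v<m → bal v (<-≤-trans v<m m≤n))
  outside
  where
    outside : Balanced m X → Balanced n X
    outside bal v v<n with v <? m
    ... | yes v<m = bal v v<m
    ... | no v≮m  = trans (avoid-indeg av) (sym (avoid-outdeg av))
      where av = below-avoid (≮⇒≥ v≮m) below

-- 3. Eulerian tests and the counts EE, EO

_≡₂_ : ℕ → ℕ → Set
a ≡₂ b = a % 2 ≡ b % 2

+-≡₂ : ∀ a a' b b' → a ≡₂ a' → b ≡₂ b' → (a + b) ≡₂ (a' + b')
+-≡₂ a a' b b' p q = begin
    (a + b) % 2           ≡⟨ %-distribˡ-+ a b 2 ⟩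
    (a % 2 + b % 2) % 2   ≡⟨ cong₂ (λ x y → (x + y) % 2) p q ⟩
    (a' % 2 + b' % 2) % 2 ≡⟨ sym (%-distribˡ-+ a' b' 2) ⟩
    (a' + b') % 2         ∎

≡₂-%2 : ∀ k → k ≡₂ (k % 2)
≡₂-%2 k = sym (m%n%n≡m%n k 2)

-- A test of an arc list X on n vertices, X standing for a subgraph with d further
-- edges (those of contracted paths).
record EulerianTest : Set where
  field
    test      : ℕ → List Arc → ℕ → Bool
    invariant : ∀ {n X Y d e} → X ~ Y → (d + length X) ≡₂ (e + length Y) →
                test n X d ≡ test n Y e
    reject    : ∀ {n X d v} → v < n → Unbalanced v X → test n X d ≡ false
    restrict  : ∀ {m n X d} → m ≤ n → Below m X → test n X d ≡ test m X d

eulerianTest : EulerianTest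
eulerianTest = record
  { test      = λ n X _ → isEulerian n X
  ; invariant = λ {n} {X} {Y} X~Y _ → isEulerian-~ n X Y X~Y
  ; reject    = λ {n} {X} → isEulerian-reject n X
  ; restrict  = λ {m} {n} {X} → isEulerian-restrict m n X
  }

hasParity : Bool → ℕ → Bool
hasParity par m = if par then evenB m else not (evenB m)

parityTest : Bool → EulerianTest
parityTest par = record
  { test      = λ n X d → isEulerian n X ∧ hasParity par (d + length X)
  ; invariant = λ {n} {X} {Y} X~Y p → cong₂ _∧_ (isEulerian-~ n X Y X~Y)
                                    (cong (λ r → if par then r ≡ᵇ 0 else not (r ≡ᵇ 0)) p)
  ; reject    = λ {n} {X} v<n ub → cong (_∧ _) (isEulerian-reject n X v<n ub)
  ; restrict  = λ {m} {n} {X} m≤n below → cong (_∧ _) (isEulerian-restrict m n X m≤n below)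
  }

countEul-parity : ∀ n par Hs →
  countEul n par Hs ≡ count (λ H → EulerianTest.test (parityTest par) n H 0) Hs
countEul-parity n par [] = refl
countEul-parity n par (H ∷ Hs) with isEulerian n H | evenB (length H) | par
... | false | _     | _     = countEul-parity n _ Hs
... | true  | true  | true  = cong suc (countEul-parity n _ Hs)
... | true  | true  | false = countEul-parity n _ Hs
... | true  | false | true  = countEul-parity n _ Hs
... | true  | false | false = cong suc (countEul-parity n _ Hs)

countEul-total : ∀ n Hs → countEul n true Hs + countEul n false Hs ≡ count (isEulerian n) Hs
countEul-total n [] = refl
countEul-total n (H ∷ Hs) with isEulerian n H | evenB (length H)
... | false | _     = countEul-total n Hs
... | true  | true  = cong suc (countEul-total n Hs)
... | true  | false = trans (+-suc (countEul n true Hs) _) (cong suc (countEul-total n Hs))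

-- 4. Contracting directed paths

-- The directed path from u to w through the vertices s, s+1, …, s+k-1, every arc
-- oriented by b as in orientArcs (b = false reverses the path).
dpath : Bool → ℕ → ℕ → ℕ → ℕ → List Arc
dpath b u s zero    w = arc b u w ∷ []
dpath b u s (suc k) w = arc b u s ∷ dpath b s (suc s) k w

dpath-avoid : ∀ b {u s k w v} → u ≢ v → w ≢ v → v < s ⊎ s + k ≤ v → Avoid v (dpath b u s k w)
dpath-avoid b {k = zero} u≢v w≢v _ = arc-misses b u≢v w≢v ∷ []
dpath-avoid b {u} {s} {suc k} {w} {v} u≢v w≢v outside =
  arc-misses b u≢v s≢v ∷ dpath-avoid b s≢v w≢v (⊎-map m<n⇒m<1+n (subst (_≤ v) (+-suc s k)) outside)
  where
    s≢v : s ≢ v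
    s≢v = [ >⇒≢ , (λ end≤v → <⇒≢ (<-≤-trans (m<m+n s z<s) end≤v)) ] outside

-- A chain: segments whose internal vertices are numbered consecutively from s on.
-- A segment is a path from `from` to `to` with `inner` internal vertices, all its
-- arcs oriented by `forward`.
record Segment : Set where
  constructor seg
  field
    forward : Bool
    from    : ℕ
    inner   : ℕ
    to      : ℕ

chainArcs : ℕ → List Segment → List Arc
chainArcs s [] = []
chainArcs s (seg b u k w ∷ ps) = dpath b u s k w ++ chainArcs (s + k) ps

-- One past the last internal vertex of the chain.
chainEnd : ℕ → List Segment → ℕ
chainEnd s [] = s
chainEnd s (seg b u k w ∷ ps) = chainEnd (s + k) ps

chainEnd-≥ : ∀ s ps → s ≤ chainEnd s ps
chainEnd-≥ s [] = ≤-refl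
chainEnd-≥ s (seg b u k w ∷ ps) = ≤-trans (m≤m+n s k) (chainEnd-≥ (s + k) ps)

EndsBelow : ℕ → Segment → Set
EndsBelow m (seg _ u _ w) = u < m × w < m

chain-avoid : ∀ {m v} s ps → All (EndsBelow m) ps → m ≤ v → v < s ⊎ chainEnd s ps ≤ v →
              Avoid v (chainArcs s ps)
chain-avoid s [] _ _ _ = []
chain-avoid s (seg b u k w ∷ ps) ((u<m , w<m) ∷ ends) m≤v outside =
  ++⁺ (dpath-avoid b (<⇒≢ (<-≤-trans u<m m≤v)) (<⇒≢ (<-≤-trans w<m m≤v))
                     (⊎-map id (≤-trans (chainEnd-≥ (s + k) ps)) outside))
      (chain-avoid (s + k) ps ends m≤v (⊎-map (λ v<s → <-≤-trans v<s (m≤m+n s k)) id outside))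

halve : List Segment → List Segment
halve [] = []
halve (seg b u k w ∷ ps) = seg b u (k % 2) w ∷ halve ps

module _ (T : EulerianTest) where
  open EulerianTest T

  completions : ℕ → List Arc → ℕ → List Arc → ℕ
  completions n Pre d R = count (λ H → test n (Pre ++ H) d) (sublists R)

  -- The count for the contracted digraph: each segment becomes one arc from `from`
  -- to `to`, its internal vertices counting as extra edges.
  reduced : ℕ → List Segment → List Arc → ℕ → ℕ
  reduced m [] Pre d = if test m Pre d then 1 else 0
  reduced m (seg b u k w ∷ ps) Pre d = reduced m ps Pre d + reduced m ps (Pre ++ arc b u w ∷ []) (k + d)

  reduced-restrict : ∀ {m n} ps Pre d → m ≤ n → All (EndsBelow m) ps → Below m Pre →
                     reduced n ps Pre d ≡ reduced m ps Pre d
  reduced-restrict [] Pre d m≤n _ pre = cong (λ t → if t then 1 else 0) (restrict m≤n pre)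
  reduced-restrict (seg b u k w ∷ ps) Pre d m≤n ((u<m , w<m) ∷ ends) pre =
    cong₂ _+_ (reduced-restrict ps Pre d m≤n ends pre)
              (reduced-restrict ps _ (k + d) m≤n ends (++⁺ pre (arc-below b u<m w<m ∷ [])))

  reduced-parity : ∀ {m} ps Pre d e → d ≡₂ e → reduced m ps Pre d ≡ reduced m (halve ps) Pre e
  reduced-parity [] Pre d e d≡₂e =
    cong (λ t → if t then 1 else 0) (invariant (~-refl Pre) (+-≡₂ d e (length Pre) (length Pre) d≡₂e refl))
  reduced-parity (seg b u k w ∷ ps) Pre d e d≡₂e =
    cong₂ _+_ (reduced-parity ps Pre d e d≡₂e)
              (reduced-parity ps (Pre ++ arc b u w ∷ []) (k + d) (k % 2 + e) (+-≡₂ k (k % 2) d e (≡₂-%2 k) d≡₂e))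

  module _ (n : ℕ) where

    completions-[] : ∀ Pre d → completions n Pre d [] ≡ (if test n Pre d then 1 else 0)
    completions-[] Pre d = cong (λ X → if test n X d then 1 else 0) (++-identityʳ Pre)

    completions-∷ : ∀ Pre d a R →
      completions n Pre d (a ∷ R) ≡ completions n Pre d R + completions n (Pre ++ a ∷ []) d R
    completions-∷ Pre d a R =
      trans (count-sublists-∷ _ a R)
            (cong (completions n Pre d R +_)
                  (count-ext (λ H → cong (λ X → test n X d) (sym (++-assoc Pre (a ∷ []) H))) (sublists R)))

    completions-unbalanced : ∀ {Pre d R v} → v < n → Avoid v R → Unbalanced v Pre →
                             completions n Pre d R ≡ 0
    completions-unbalanced {Pre} {v = v} v<n avoid ub =
      count-sublists-none (Misses v) _ (λ H av → reject v<n (proj₁ (unbalanced-++ Pre H av ub))) avoid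

    completions-shift : ∀ X Y d R → X ~ Y → length X ≡ suc (length Y) →
                        completions n X d R ≡ completions n Y (suc d) R
    completions-shift X Y d R X~Y len =
      count-ext (λ H → invariant {n} {X ++ H} {Y ++ H} {d} {suc d}
                                 (~-++ X Y H H X~Y (~-refl H)) (cong (_% 2) (lengths H)))
                (sublists R)
      where
        lengths : ∀ H → d + length (X ++ H) ≡ suc d + length (Y ++ H)
        lengths H = begin
            d + length (X ++ H)               ≡⟨ cong (d +_) (length-++ X) ⟩
            d + (length X + length H)         ≡⟨ cong (λ l → d + (l + length H)) len ⟩
            d + suc (length Y + length H)     ≡⟨ +-suc d _ ⟩
            suc d + (length Y + length H)     ≡⟨ cong (suc d +_) (sym (length-++ Y)) ⟩
            suc d + length (Y ++ H)           ∎

    record FreshVertex (v u w : ℕ) (Pre R : List Arc) : Set where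
      field
        inGraph   : v < n
        notStart  : u ≢ v
        notEnd    : w ≢ v
        notInPre  : Avoid v Pre
        notInRest : Avoid v R

    FreshInterior : ℕ → ℕ → ℕ → ℕ → List Arc → List Arc → Set
    FreshInterior u w s k Pre R = ∀ v → s ≤ v → v < s + k → FreshVertex v u w Pre R

    -- Path contraction: a subgraph contains all arcs of a directed path with fresh
    -- interior or none, so the path acts as one arc carrying k extra edges.
    contractPath : ∀ b u s k w Pre R d → FreshInterior u w s k Pre R →
      completions n Pre d (dpath b u s k w ++ R) ≡
      completions n Pre d R + completions n (Pre ++ arc b u w ∷ []) (k + d) R
    contractPath b u s zero w Pre R d _ = completions-∷ Pre d (arc b u w) R
    contractPath b u s (suc k) w Pre R d fresh = begin
        completions n Pre d (a₁ ∷ X)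
      ≡⟨ completions-∷ Pre d a₁ X ⟩
        completions n Pre d X + completions n Pre₁ d X
      ≡⟨ cong₂ _+_ (contractPath b s (suc s) k w Pre R d (shifted (λ _ _ → FreshVertex.notInPre)))
                   (contractPath b s (suc s) k w Pre₁ R d (shifted extend)) ⟩
        (completions n Pre d R + completions n (Pre ++ a₂ ∷ []) (k + d) R)
          + (completions n Pre₁ d R + completions n (Pre₁ ++ a₂ ∷ []) (k + d) R)
      ≡⟨ cong₂ _+_ (cong (completions n Pre d R +_) (completions-unbalanced S.inGraph S.notInRest only-a₂))
                   (cong₂ _+_ (completions-unbalanced S.inGraph S.notInRest only-a₁) joined) ⟩
        (completions n Pre d R + 0) + completions n (Pre ++ a ∷ []) (suc k + d) R
      ≡⟨ cong (_+ completions n (Pre ++ a ∷ []) (suc k + d) R) (+-identityʳ (completions n Pre d R)) ⟩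
        completions n Pre d R + completions n (Pre ++ a ∷ []) (suc k + d) R ∎
      where
        a₁ = arc b u s
        a₂ = arc b s w
        a  = arc b u w
        X  = dpath b s (suc s) k w ++ R
        Pre₁ = Pre ++ a₁ ∷ []
        module S = FreshVertex (fresh s ≤-refl (m<m+n s z<s))

        -- Taking only a₂ or only a₁ unbalances s.
        only-a₂ : Unbalanced s (Pre ++ a₂ ∷ [])
        only-a₂ = proj₂ (unbalanced-++ (a₂ ∷ []) Pre S.notInPre (proj₂ (pendant-unbalanced b S.notEnd)))
        only-a₁ : Unbalanced s Pre₁
        only-a₁ = proj₂ (unbalanced-++ (a₁ ∷ []) Pre S.notInPre (proj₁ (pendant-unbalanced b S.notStart)))

        -- Taking both amounts to taking a, with one more edge.
        joined : completions n (Pre₁ ++ a₂ ∷ []) (k + d) R ≡ completions n (Pre ++ a ∷ []) (suc (k + d)) R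
        joined = trans (cong (λ Z → completions n Z (k + d) R) (++-assoc Pre (a₁ ∷ []) (a₂ ∷ [])))
                       (completions-shift (Pre ++ a₁ ∷ a₂ ∷ []) (Pre ++ a ∷ []) (k + d) R
                                          (~-++ Pre Pre _ _ (~-refl Pre) (splice-~ b u s w))
                                          (trans (length-++-sucʳ Pre a₁ (a₂ ∷ []))
                                                 (cong suc (trans (length-++ Pre) (sym (length-++ Pre))))))

        shifted : ∀ {Q} → (∀ v → s < v → FreshVertex v u w Pre R → Avoid v Q) →
                  FreshInterior s w (suc s) k Q R
        shifted avoidQ v s<v v<end = record
          { inGraph = F.inGraph ; notStart = <⇒≢ s<v ; notEnd = F.notEnd
          ; notInPre = avoidQ v s<v Fv ; notInRest = F.notInRest }
          where
            Fv = fresh v (<⇒≤ s<v) (subst (v <_) (sym (+-suc s k)) v<end)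
            module F = FreshVertex Fv

        extend : ∀ v → s < v → FreshVertex v u w Pre R → Avoid v Pre₁
        extend v s<v Fv = ++⁺ (FreshVertex.notInPre Fv) (arc-misses b (FreshVertex.notStart Fv) (<⇒≢ s<v) ∷ [])

    -- Claw contraction: a vertex w outside R with in-arc from p and out-arcs to q and
    -- r is used by no arc, or by p→w with exactly one out-arc, acting as p→r or p→q.
    contractClaw : ∀ {p q r w R d} → w < n → p ≢ w → q ≢ w → r ≢ w → Avoid w R →
      completions n [] d ((p , w) ∷ (w , q) ∷ (w , r) ∷ R) ≡
      completions n [] d R + completions n ((p , r) ∷ []) (suc d) R + completions n ((p , q) ∷ []) (suc d) R
    contractClaw {p} {q} {r} {w} {R} {d} w<n p≢w q≢w r≢w avoid = begin
        completions n [] d (a ∷ b ∷ c ∷ R)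
      ≡⟨ expand ⟩
        ((C [] + C (c ∷ [])) + (C (b ∷ []) + C (b ∷ c ∷ [])))
          + ((C (a ∷ []) + C (a ∷ c ∷ [])) + (C (a ∷ b ∷ []) + C (a ∷ b ∷ c ∷ [])))
      ≡⟨ cong₂ _+_ (cong₂ _+_ (cong (C [] +_) (dead c-only)) (cong₂ _+_ (dead b-only) (dead b-c)))
                   (cong₂ _+_ (cong₂ _+_ (dead a-only) (through r)) (cong₂ _+_ (through q) (dead a-b-c))) ⟩
        ((C [] + 0) + 0) + (C' (p , r) + (C' (p , q) + 0))
      ≡⟨ cong₂ _+_ (trans (+-identityʳ (C [] + 0)) (+-identityʳ (C [])))
                   (cong (C' (p , r) +_) (+-identityʳ (C' (p , q)))) ⟩
        C [] + (C' (p , r) + C' (p , q))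
      ≡⟨ sym (+-assoc (C []) _ _) ⟩
        C [] + C' (p , r) + C' (p , q) ∎
      where
        a = (p , w)
        b = (w , q)
        c = (w , r)
        C : List Arc → ℕ
        C Pre = completions n Pre d R
        C' : Arc → ℕ
        C' e = completions n (e ∷ []) (suc d) R

        expand : completions n [] d (a ∷ b ∷ c ∷ R) ≡
          ((C [] + C (c ∷ [])) + (C (b ∷ []) + C (b ∷ c ∷ [])))
            + ((C (a ∷ []) + C (a ∷ c ∷ [])) + (C (a ∷ b ∷ []) + C (a ∷ b ∷ c ∷ [])))
        expand = trans (completions-∷ [] d a (b ∷ c ∷ R))
          (cong₂ _+_ (trans (completions-∷ [] d b (c ∷ R)) (cong₂ _+_ (completions-∷ [] d c R) (completions-∷ (b ∷ []) d c R)))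
                     (trans (completions-∷ (a ∷ []) d b (c ∷ R))
                            (cong₂ _+_ (completions-∷ (a ∷ []) d c R) (completions-∷ (a ∷ b ∷ []) d c R))))

        dead : ∀ {Pre} → Unbalanced w Pre → C Pre ≡ 0
        dead = completions-unbalanced w<n avoid

        through : ∀ z → C (a ∷ (w , z) ∷ []) ≡ C' (p , z)
        through z = completions-shift (a ∷ (w , z) ∷ []) ((p , z) ∷ []) d R (splice-~ true p w z) refl

        -- The other five subsets of the claw unbalance w.
        c-only : Unbalanced w (c ∷ [])
        c-only rewrite ≡ᵇ-false r≢w | ≡ᵇ-refl w = λ ()
        b-only : Unbalanced w (b ∷ [])
        b-only rewrite ≡ᵇ-false q≢w | ≡ᵇ-refl w = λ ()
        b-c : Unbalanced w (b ∷ c ∷ [])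
        b-c rewrite ≡ᵇ-false q≢w | ≡ᵇ-false r≢w | ≡ᵇ-refl w = λ ()
        a-only : Unbalanced w (a ∷ [])
        a-only rewrite ≡ᵇ-false p≢w | ≡ᵇ-refl w = λ ()
        a-b-c : Unbalanced w (a ∷ b ∷ c ∷ [])
        a-b-c rewrite ≡ᵇ-false p≢w | ≡ᵇ-false q≢w | ≡ᵇ-false r≢w | ≡ᵇ-refl w = λ ()

    contractChain : ∀ {m} s ps Pre d → m ≤ s → All (EndsBelow m) ps → Below m Pre → chainEnd s ps ≤ n →
                    completions n Pre d (chainArcs s ps) ≡ reduced n ps Pre d
    contractChain s [] Pre d _ _ _ _ = completions-[] Pre d
    contractChain {m} s (seg b u k w ∷ ps) Pre d m≤s ((u<m , w<m) ∷ ends) pre end≤n = begin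
        completions n Pre d (dpath b u s k w ++ R)
      ≡⟨ contractPath b u s k w Pre R d fresh ⟩
        completions n Pre d R + completions n (Pre ++ arc b u w ∷ []) (k + d) R
      ≡⟨ cong₂ _+_ (contractChain (s + k) ps Pre d m≤s+k ends pre end≤n)
                   (contractChain (s + k) ps _ (k + d) m≤s+k ends (++⁺ pre (arc-below b u<m w<m ∷ [])) end≤n) ⟩
        reduced n ps Pre d + reduced n ps (Pre ++ arc b u w ∷ []) (k + d) ∎
      where
        R = chainArcs (s + k) ps
        m≤s+k = ≤-trans m≤s (m≤m+n s k)
        fresh : FreshInterior u w s k Pre R
        fresh v s≤v v<s+k = record
          { inGraph   = <-≤-trans v<s+k (≤-trans (chainEnd-≥ (s + k) ps) end≤n)
          ; notStart  = <⇒≢ (<-≤-trans u<m m≤v)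
          ; notEnd    = <⇒≢ (<-≤-trans w<m m≤v)
          ; notInPre  = below-avoid m≤v pre
          ; notInRest = chain-avoid (s + k) ps ends m≤v (inj₁ v<s+k)
          }
          where m≤v = ≤-trans m≤s s≤v

countChain : ∀ T {n s} ps Pre d → All (EndsBelow s) ps → Below s Pre → chainEnd s ps ≤ n →
             completions T n Pre d (chainArcs s ps) ≡ reduced T s (halve ps) Pre d
countChain T {n} {s} ps Pre d ends pre end≤n = begin
    completions T n Pre d (chainArcs s ps)
  ≡⟨ contractChain T n s ps Pre d ≤-refl ends pre end≤n ⟩
    reduced T n ps Pre d
  ≡⟨ reduced-restrict T ps Pre d (≤-trans (chainEnd-≥ s ps) end≤n) ends pre ⟩
    reduced T s ps Pre d
  ≡⟨ reduced-parity T ps Pre d d refl ⟩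
    reduced T s (halve ps) Pre d ∎

-- 5. Graphs whose edges form a chain

chainEdges : ℕ → List Segment → List (ℕ × ℕ)
chainEdges s [] = []
chainEdges s (seg b u k w ∷ ps) = pathEdges u s k w ++ chainEdges (s + k) ps

appendBits : (xs ys : List (ℕ × ℕ)) → Vec Bool (length xs) → Vec Bool (length ys) →
             Vec Bool (length (xs ++ ys))
appendBits [] ys [] bs = bs
appendBits (x ∷ xs) ys (b ∷ as) bs = b ∷ appendBits xs ys as bs

orientArcs-append : (xs ys : List (ℕ × ℕ)) → ∀ as bs →
  orientArcs (xs ++ ys) (appendBits xs ys as bs) ≡ orientArcs xs as ++ orientArcs ys bs
orientArcs-append [] ys [] bs = refl
orientArcs-append ((u , w) ∷ xs) ys (true  ∷ as) bs = cong ((u , w) ∷_) (orientArcs-append xs ys as bs)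
orientArcs-append ((u , w) ∷ xs) ys (false ∷ as) bs = cong ((w , u) ∷_) (orientArcs-append xs ys as bs)

orientArcs-path : ∀ b u s k w → orientArcs (pathEdges u s k w) (replicate _ b) ≡ dpath b u s k w
orientArcs-path true  u s zero    w = refl
orientArcs-path false u s zero    w = refl
orientArcs-path true  u s (suc k) w = cong ((u , s) ∷_) (orientArcs-path true s (suc s) k w)
orientArcs-path false u s (suc k) w = cong ((s , u) ∷_) (orientArcs-path false s (suc s) k w)

chainOrientation : ∀ s ps → Vec Bool (length (chainEdges s ps))
chainOrientation s [] = []
chainOrientation s (seg b u k w ∷ ps) =
  appendBits (pathEdges u s k w) _ (replicate _ b) (chainOrientation (s + k) ps)

orientArcs-chain : ∀ s ps → orientArcs (chainEdges s ps) (chainOrientation s ps) ≡ chainArcs s ps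
orientArcs-chain s [] = refl
orientArcs-chain s (seg b u k w ∷ ps) =
  trans (orientArcs-append (pathEdges u s k w) _ _ _)
        (cong₂ _++_ (orientArcs-path b u s k w) (orientArcs-chain (s + k) ps))

orientAlong : ∀ G s ps → E G ≡ chainEdges s ps → Orientation G
orientAlong G s ps eq = subst (λ es → Vec Bool (length es)) (sym eq) (chainOrientation s ps)

arcs-orientAlong : ∀ G s ps (eq : E G ≡ chainEdges s ps) → arcs G (orientAlong G s ps eq) ≡ chainArcs s ps
arcs-orientAlong G s ps eq = trans (transport eq (chainOrientation s ps)) (orientArcs-chain s ps)
  where
    transport : ∀ {es es'} (eq : es ≡ es') bs →
      orientArcs es (subst (λ xs → Vec Bool (length xs)) (sym eq) bs) ≡ orientArcs es' bs
    transport refl bs = refl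

indeg-∷ : ∀ a X v → indeg X v ≤ indeg (a ∷ X) v
indeg-∷ (_ , c) X v with c ≡ᵇ v
... | true  = n≤1+n _
... | false = ≤-refl

indeg-++ˡ : ∀ X Y v → indeg X v ≤ indeg (X ++ Y) v
indeg-++ˡ X Y v = subst (indeg X v ≤_) (sym (indeg-++ X Y v)) (m≤m+n _ _)

indeg-++ʳ : ∀ X Y v → indeg Y v ≤ indeg (X ++ Y) v
indeg-++ʳ X Y v = subst (indeg Y v ≤_) (sym (indeg-++ X Y v)) (m≤n+m _ _)

enters : Arc → ℕ → ℕ
enters (_ , c) v = if c ≡ᵇ v then 1 else 0

enters-≤ : ∀ a X v → enters a v ≤ indeg (a ∷ X) v
enters-≤ (_ , c) X v with c ≡ᵇ v
... | true  = s≤s z≤n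
... | false = z≤n

enters-head : ∀ u c X → 1 ≤ indeg ((u , c) ∷ X) c
enters-head u c X = subst (_≤ indeg ((u , c) ∷ X) c) (cong (λ t → if t then 1 else 0) (≡ᵇ-refl c)) (enters-≤ (u , c) X c)

heads : List Segment → ℕ → ℕ
heads [] v = 0
heads (seg b u _ w ∷ ps) v = enters (arc b u w) v + heads ps v

dpath-head : ∀ b u s k w v → enters (arc b u w) v ≤ indeg (dpath b u s k w) v
dpath-head b     u s zero    w v = enters-≤ (arc b u w) [] v
dpath-head true  u s (suc k) w v = ≤-trans (dpath-head true s (suc s) k w v) (indeg-∷ (u , s) (dpath true s (suc s) k w) v)
dpath-head false u s (suc k) w v = enters-≤ (s , u) (dpath false s (suc s) k w) v

dpath-start : ∀ b u s k w → 1 ≤ indeg (dpath b u s (suc k) w) s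
dpath-start true  u s k w = enters-head u s (dpath true s (suc s) k w)
dpath-start false u s k w =
  ≤-trans (subst (_≤ indeg rest s) (cong (λ t → if t then 1 else 0) (≡ᵇ-refl s)) (dpath-head false s (suc s) k w s))
          (indeg-∷ (s , u) rest s)
  where rest = dpath false s (suc s) k w

dpath-interior : ∀ b u s k w v → s ≤ v → v < s + k → 1 ≤ indeg (dpath b u s k w) v
dpath-interior b u s zero w v s≤v v<s = ⊥-elim (<⇒≱ (subst (v <_) (+-identityʳ s) v<s) s≤v)
dpath-interior b u s (suc k) w v s≤v v<end with s ≟ v
... | yes refl = dpath-start b u s k w
... | no  s≢v  = ≤-trans (dpath-interior b s (suc s) k w v (≤∧≢⇒< s≤v s≢v) (subst (v <_) (+-suc s k) v<end))
                         (indeg-∷ (arc b u s) (dpath b s (suc s) k w) v)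

chain-heads : ∀ s ps v → heads ps v ≤ indeg (chainArcs s ps) v
chain-heads s [] v = z≤n
chain-heads s (seg b u k w ∷ ps) v =
  subst (_ ≤_) (sym (indeg-++ (dpath b u s k w) _ v))
        (+-mono-≤ (dpath-head b u s k w v) (chain-heads (s + k) ps v))

chain-interior : ∀ s ps v → s ≤ v → v < chainEnd s ps → 1 ≤ indeg (chainArcs s ps) v
chain-interior s [] v s≤v v<s = ⊥-elim (<⇒≱ v<s s≤v)
chain-interior s (seg b u k w ∷ ps) v s≤v v<end with v <? s + k
... | yes v<s+k = ≤-trans (dpath-interior b u s k w v s≤v v<s+k) (indeg-++ˡ (dpath b u s k w) _ v)
... | no  v≮s+k = ≤-trans (chain-interior (s + k) ps v (≮⇒≥ v≮s+k) v<end) (indeg-++ʳ (dpath b u s k w) _ v)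

hx-elsewhere : ∀ {x v} → v ≢ x → hx x v ≡ 0
hx-elsewhere v≢x = cong (λ t → if t then 1 else 0) (≡ᵇ-false v≢x)

-- Every base vertex v < s has at least h_x(v)+1 segments pointing to it (a check
-- done by evaluation on concrete chains).
headsSuffice : ℕ → ℕ → List Segment → Bool
headsSuffice x s ps = allB (λ v → suc (hx x v) ≤ᵇ heads ps v) (upTo s)

-- Then the whole chain meets the in-degree bound of h_x: internal vertices are
-- entered by their path.
chain-indeg : ∀ x s ps → x < s → headsSuffice x s ps ≡ true →
              ∀ v → v < chainEnd s ps → suc (hx x v) ≤ indeg (chainArcs s ps) v
chain-indeg x s ps x<s ok v v<end with v <? s
... | yes v<s = ≤-trans (≤ᵇ⇒≤ _ _ (Equivalence.from T-≡ (Equivalence.to (allB-true _ (upTo s)) ok v (∈-upTo⁺ v<s))))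
                        (chain-heads s ps v)
... | no  v≮s = subst (λ h → suc h ≤ indeg (chainArcs s ps) v)
                      (sym (hx-elsewhere (λ v≡x → v≮s (subst (_< s) (sym v≡x) x<s))))
                      (chain-interior s ps v (≮⇒≥ v≮s) v<end)

chainAT : ∀ G s ps x (eq : E G ≡ chainEdges s ps) → nV G ≡ chainEnd s ps → x < s →
          headsSuffice x s ps ≡ true → EE G (orientAlong G s ps eq) ≢ EO G (orientAlong G s ps eq) → IsAT G (hx x)
chainAT G s ps x eq size x<s ok differ = orientAlong G s ps eq , differ , λ v v<n →
  subst (λ X → suc (hx x v) ≤ indeg X v) (sym (arcs-orientAlong G s ps eq))
        (chain-indeg x s ps x<s ok v (subst (v <_) size v<n))

chainCount : ∀ T G s ps (eq : E G ≡ chainEdges s ps) → All (EndsBelow s) ps → chainEnd s ps ≤ nV G →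
             completions T (nV G) [] 0 (arcs G (orientAlong G s ps eq)) ≡ reduced T s (halve ps) [] 0
chainCount T G s ps eq ends end≤n =
  trans (cong (completions T (nV G) [] 0) (arcs-orientAlong G s ps eq)) (countChain T ps [] 0 ends [] end≤n)

-- 6. The three parts

double≢odd : ∀ a m → a + a ≢ suc (m + m)
double≢odd zero    m       ()
double≢odd (suc a) zero    eq rewrite +-suc a a with eq
... | ()
double≢odd (suc a) (suc m) eq rewrite +-suc a a | +-suc m m = double≢odd a m (suc-injective (suc-injective eq))

odd-sum-differs : ∀ a b m → a + b ≡ suc (m + m) → a ≢ b
odd-sum-differs a .a m eq refl = double≢odd a m eq

-- (i) θ-graph, x = 0 (t = false) or x = 1 (t = true): P₁ leaves x, P₂ and P₃ enter it.
θSegments : Bool → ℕ → ℕ → ℕ → List Segment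
θSegments t i j k = seg (not t) 0 i 1 ∷ seg t 0 j 1 ∷ seg t 0 k 1 ∷ []

θ-edges : ∀ t i j k → E (thetaGraph i j k) ≡ chainEdges 2 (θSegments t i j k)
θ-edges t i j k = cong (λ es → pathEdges 0 2 i 1 ++ pathEdges 0 (2 + i) j 1 ++ es) (sym (++-identityʳ _))

θ-ends : ∀ t i j k → All (EndsBelow 2) (θSegments t i j k)
θ-ends t i j k = (0<2 , 1<2) ∷ (0<2 , 1<2) ∷ (0<2 , 1<2) ∷ []
  where
    0<2 : 0 < 2
    0<2 = z<s
    1<2 : 1 < 2
    1<2 = s≤s z<s

-- The contracted θ-graph (one arc leaving x, two entering it) has 3 Eulerian
-- subgraphs: the empty one and two 2-cycles; so EE + EO is odd.
θ-endpoint-AT : ∀ t i j k → IsAT (thetaGraph i j k) (hx (if t then 1 else 0))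
θ-endpoint-AT t i j k =
  chainAT G 2 ps x (θ-edges t i j k) refl (x<2 t) (enough t) (odd-sum-differs (EE G o) (EO G o) 1 total)
  where
    G = thetaGraph i j k
    ps = θSegments t i j k
    x = if t then 1 else 0

    x<2 : ∀ t → (if t then 1 else 0) < 2
    x<2 true  = s≤s z<s
    x<2 false = z<s
    enough : ∀ t → headsSuffice (if t then 1 else 0) 2 (θSegments t i j k) ≡ true
    enough true  = refl
    enough false = refl
    three : ∀ t → reduced eulerianTest 2 (halve (θSegments t i j k)) [] 0 ≡ 3
    three true  = refl
    three false = refl

    o = orientAlong G 2 ps (θ-edges t i j k)
    total : EE G o + EO G o ≡ 3
    total = trans (countEul-total (nV G) (sublists (arcs G o)))
                  (trans (chainCount eulerianTest G 2 ps (θ-edges t i j k) (θ-ends t i j k) ≤-refl) (three t))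

θ-AT : ∀ i j k x → x ≡ 0 ⊎ x ≡ 1 → IsAT (thetaGraph i j k) (hx x)
θ-AT i j k .0 (inj₁ refl) = θ-endpoint-AT false i j k
θ-AT i j k .1 (inj₂ refl) = θ-endpoint-AT true i j k

-- (ii), (iii) T-graph with x = 0, z₁ = 1, z₂ = 2, z₃ = 3: the triangle edges z₁z₂,
-- z₁z₃, z₂z₃ oriented by t₁ t₂ t₃ and the paths P₁, P₂, P₃ from x by d₁ d₂ d₃.
tSegments : Bool → Bool → Bool → Bool → Bool → Bool → ℕ → ℕ → ℕ → List Segment
tSegments t₁ t₂ t₃ d₁ d₂ d₃ i j k =
  seg t₁ 1 0 2 ∷ seg t₂ 1 0 3 ∷ seg t₃ 2 0 3 ∷ seg d₁ 0 i 1 ∷ seg d₂ 0 j 2 ∷ seg d₃ 0 k 3 ∷ []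

T-edges : ∀ t₁ t₂ t₃ d₁ d₂ d₃ i j k → E (TGraph i j k) ≡ chainEdges 4 (tSegments t₁ t₂ t₃ d₁ d₂ d₃ i j k)
T-edges _ _ _ _ _ _ i j k =
  cong (λ es → (1 , 2) ∷ (1 , 3) ∷ (2 , 3) ∷ pathEdges 0 4 i 1 ++ pathEdges 0 (4 + i) j 2 ++ es)
       (sym (++-identityʳ _))

T-ends : ∀ t₁ t₂ t₃ d₁ d₂ d₃ i j k → All (EndsBelow 4) (tSegments t₁ t₂ t₃ d₁ d₂ d₃ i j k)
T-ends _ _ _ _ _ _ i j k = (1<4 , 2<4) ∷ (1<4 , 3<4) ∷ (2<4 , 3<4) ∷ (0<4 , 1<4) ∷ (0<4 , 2<4) ∷ (0<4 , 3<4) ∷ []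
  where
    0<4 : 0 < 4
    0<4 = z<s
    1<4 : 1 < 4
    1<4 = s≤s z<s
    2<4 : 2 < 4
    2<4 = s≤s (s≤s z<s)
    3<4 : 3 < 4
    3<4 = s≤s (s≤s (s≤s z<s))

CountsDiffer : List Segment → Set
CountsDiffer ps = reduced (parityTest true) 4 ps [] 0 ≢ reduced (parityTest false) 4 ps [] 0

-- For one orientation of the T-graph, AT reduces to the contracted counts, which
-- only depend on the lengths of the paths mod 2.
TGraphAT : ∀ t₁ t₂ t₃ d₁ d₂ d₃ i j k → headsSuffice 0 4 (tSegments t₁ t₂ t₃ d₁ d₂ d₃ i j k) ≡ true →
           CountsDiffer (tSegments t₁ t₂ t₃ d₁ d₂ d₃ (i % 2) (j % 2) (k % 2)) → IsAT (TGraph i j k) (hx 0)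
TGraphAT t₁ t₂ t₃ d₁ d₂ d₃ i j k ok differ =
  chainAT G 4 ps 0 eq refl z<s ok (λ e → differ (trans (sym (counts true)) (trans e (counts false))))
  where
    G = TGraph i j k
    ps = tSegments t₁ t₂ t₃ d₁ d₂ d₃ i j k
    eq = T-edges t₁ t₂ t₃ d₁ d₂ d₃ i j k
    o = orientAlong G 4 ps eq
    counts : ∀ par → countEul (nV G) par (sublists (arcs G o)) ≡ reduced (parityTest par) 4 (halve ps) [] 0
    counts par = trans (countEul-parity (nV G) par (sublists (arcs G o)))
                       (chainCount (parityTest par) G 4 ps eq (T-ends t₁ t₂ t₃ d₁ d₂ d₃ i j k) ≤-refl)

data Bit : ℕ → Set where
  bit0 : Bit 0
  bit1 : Bit 1

bit : ∀ k → Bit (k % 2)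
bit k with k % 2 | m%n<n k 2
... | 0           | _               = bit0
... | 1           | _               = bit1
... | suc (suc _) | s≤s (s≤s ())

suc-parity : ∀ a b → suc a % 2 ≢ suc b % 2 → a % 2 ≢ b % 2
suc-parity a b ne eq = ne (+-≡₂ 1 1 a b refl eq)

-- P₃ leaves x: EE ≠ EO iff P₂ and P₃ have lengths of opposite parity.
orient-jk : ℕ → ℕ → ℕ → List Segment
orient-jk = tSegments false false false false false true

differs-jk : ∀ {r₁ r₂ r₃} → Bit r₁ → Bit r₂ → Bit r₃ → r₂ ≢ r₃ → CountsDiffer (orient-jk r₁ r₂ r₃)
differs-jk _    bit0 bit0 ne = ⊥-elim (ne refl)
differs-jk _    bit1 bit1 ne = ⊥-elim (ne refl)
differs-jk bit0 bit0 bit1 _  = λ ()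
differs-jk bit1 bit0 bit1 _  = λ ()
differs-jk bit0 bit1 bit0 _  = λ ()
differs-jk bit1 bit1 bit0 _  = λ ()

-- P₃ leaves x, z₁z₂ reversed: EE ≠ EO iff P₁ and P₃ have lengths of opposite parity.
orient-ik : ℕ → ℕ → ℕ → List Segment
orient-ik = tSegments true false false false false true

differs-ik : ∀ {r₁ r₂ r₃} → Bit r₁ → Bit r₂ → Bit r₃ → r₁ ≢ r₃ → CountsDiffer (orient-ik r₁ r₂ r₃)
differs-ik bit0 _    bit0 ne = ⊥-elim (ne refl)
differs-ik bit1 _    bit1 ne = ⊥-elim (ne refl)
differs-ik bit0 bit0 bit1 _  = λ ()
differs-ik bit0 bit1 bit1 _  = λ ()
differs-ik bit1 bit0 bit0 _  = λ ()
differs-ik bit1 bit1 bit0 _  = λ ()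

-- P₂ leaves x: EE ≠ EO iff P₁ and P₂ have lengths of opposite parity.
orient-ij : ℕ → ℕ → ℕ → List Segment
orient-ij = tSegments false true true false true false

differs-ij : ∀ {r₁ r₂ r₃} → Bit r₁ → Bit r₂ → Bit r₃ → r₁ ≢ r₂ → CountsDiffer (orient-ij r₁ r₂ r₃)
differs-ij bit0 bit0 _    ne = ⊥-elim (ne refl)
differs-ij bit1 bit1 _    ne = ⊥-elim (ne refl)
differs-ij bit0 bit1 bit0 _  = λ ()
differs-ij bit0 bit1 bit1 _  = λ ()
differs-ij bit1 bit0 bit0 _  = λ ()
differs-ij bit1 bit0 bit1 _  = λ ()

T-AT : ∀ i j k → (suc i % 2 ≢ suc j % 2 ⊎ suc i % 2 ≢ suc k % 2 ⊎ suc j % 2 ≢ suc k % 2) →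
       IsAT (TGraph i j k) (hx 0)
T-AT i j k (inj₁ ij) =
  TGraphAT false true true false true false i j k refl (differs-ij (bit i) (bit j) (bit k) (suc-parity i j ij))
T-AT i j k (inj₂ (inj₁ ik)) =
  TGraphAT true false false false false true i j k refl (differs-ik (bit i) (bit j) (bit k) (suc-parity i k ik))
T-AT i j k (inj₂ (inj₂ jk)) =
  TGraphAT false false false false false true i j k refl (differs-jk (bit i) (bit j) (bit k) (suc-parity j k jk))

-- (iii) The new vertex w has in-arc from z₁ and out-arcs to z₂, z₃; the T-graph is
-- oriented with P₃ leaving x and the triangle z₂ → z₁ → z₃ → z₂.  Contracting the
-- claw at w and the paths leaves three 4-vertex digraphs with 7 Eulerian subgraphs.
TPlus-AT : ∀ i j k → IsAT (TGraphPlus i j k) (hx 0)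
TPlus-AT i j k = orientation , odd-sum-differs (EE G⁺ orientation) (EO G⁺ orientation) 3 total , degrees
  where
    G⁺ = TGraphPlus i j k
    ps = tSegments false true false false false true i j k
    eq = T-edges false true false false false true i j k
    ends = T-ends false true false false false true i j k
    w = 4 + i + j + k
    R = chainArcs 4 ps
    L = (1 , w) ∷ (w , 2) ∷ (w , 3) ∷ R

    orientation : Orientation G⁺
    orientation = false ∷ true ∷ true ∷ orientAlong (TGraph i j k) 4 ps eq

    arcs⁺ : arcs G⁺ orientation ≡ L
    arcs⁺ = cong (λ X → (1 , w) ∷ (w , 2) ∷ (w , 3) ∷ X) (arcs-orientAlong (TGraph i j k) 4 ps eq)

    4≤w : 4 ≤ w
    4≤w = chainEnd-≥ 4 ps
    base≢w : ∀ {z} → z < 4 → z ≢ w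
    base≢w z<4 = <⇒≢ (<-≤-trans z<4 4≤w)

    total : EE G⁺ orientation + EO G⁺ orientation ≡ 7
    total = begin
        EE G⁺ orientation + EO G⁺ orientation
      ≡⟨ countEul-total (nV G⁺) (sublists (arcs G⁺ orientation)) ⟩
        completions eulerianTest (nV G⁺) [] 0 (arcs G⁺ orientation)
      ≡⟨ cong (completions eulerianTest (nV G⁺) [] 0) arcs⁺ ⟩
        completions eulerianTest (nV G⁺) [] 0 L
      ≡⟨ contractClaw eulerianTest (nV G⁺) {1} {2} {3} {w} {R} {0} (n<1+n w) (base≢w (s≤s z<s)) (base≢w (s≤s (s≤s z<s)))
                      (base≢w (s≤s (s≤s (s≤s z<s)))) (chain-avoid 4 ps ends 4≤w (inj₂ ≤-refl)) ⟩
        C [] 0 + C ((1 , 3) ∷ []) 1 + C ((1 , 2) ∷ []) 1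
      ≡⟨ cong₂ _+_ (cong₂ _+_ (countChain eulerianTest ps [] 0 ends [] end≤n)
                              (countChain eulerianTest ps _ 1 ends ((s≤s z<s , s≤s (s≤s (s≤s z<s))) ∷ []) end≤n))
                   (countChain eulerianTest ps _ 1 ends ((s≤s z<s , s≤s (s≤s z<s)) ∷ []) end≤n) ⟩
        reduced eulerianTest 4 (halve ps) [] 0 + reduced eulerianTest 4 (halve ps) ((1 , 3) ∷ []) 1
          + reduced eulerianTest 4 (halve ps) ((1 , 2) ∷ []) 1
      ≡⟨⟩
        7 ∎
      where
        C : List Arc → ℕ → ℕ
        C Pre d = completions eulerianTest (nV G⁺) Pre d R
        end≤n : chainEnd 4 ps ≤ nV G⁺
        end≤n = n≤1+n w

    claw-indeg : ∀ v → v < suc w → suc (hx 0 v) ≤ indeg L v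
    claw-indeg v v<n with v <? w
    ... | yes v<w = ≤-trans (chain-indeg 0 4 ps z<s refl v v<w)
                            (≤-trans (indeg-∷ (w , 3) R v)
                                     (≤-trans (indeg-∷ (w , 2) ((w , 3) ∷ R) v) (indeg-∷ (1 , w) ((w , 2) ∷ (w , 3) ∷ R) v)))
    ... | no  v≮w = subst (λ u → suc (hx 0 u) ≤ indeg L u) (sym (≤-antisym (≤-pred v<n) (≮⇒≥ v≮w))) at-w
      where
        at-w : suc (hx 0 w) ≤ indeg L w
        at-w = subst (λ h → suc h ≤ indeg L w) (sym (hx-elsewhere (≢-sym (base≢w z<s))))
                     (enters-head 1 w ((w , 2) ∷ (w , 3) ∷ R))

    degrees : ∀ v → v < nV G⁺ → suc (hx 0 v) ≤ indeg (arcs G⁺ orientation) v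
    degrees v v<n = subst (λ X → suc (hx 0 v) ≤ indeg X v) (sym arcs⁺) (claw-indeg v v<n)

lemma7 : ((i j k x : ℕ) →
    ¬ (i ≡ 0 × j ≡ 0) → ¬ (i ≡ 0 × k ≡ 0) → ¬ (j ≡ 0 × k ≡ 0) →
    (x ≡ 0 ⊎ x ≡ 1) →
    IsAT (thetaGraph i j k) (hx x))
    ×
    ((i j k : ℕ) →
    ((suc i) % 2 ≢ (suc j) % 2 ⊎ (suc i) % 2 ≢ (suc k) % 2 ⊎ (suc j) % 2 ≢ (suc k) % 2) →
    IsAT (TGraph i j k) (hx 0))
    ×
    ((i j k : ℕ) → IsAT (TGraphPlus i j k) (hx 0))
lemma7 = (λ i j k x _ _ _ → θ-AT i j k x) , T-AT , TPlus-AT
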